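{- Let $G=(V,E)$ be a finite undirected graph (possibly with parallel edges) with $E$ partitioned into disjoint sets $E^\ell$ and $E^f$, and let $e_1,\dots,e_m$ be a fixed linear order of $E^f$. For a cycle-free set $X\subseteq E^\ell$, define the follower's response $Y(X)\subseteq E^f$ greedily: start with $Y=\emptyset$ and for $i=1,\dots,m$ add $e_i$ to $Y$ if $X\cup Y\cup\{e_i\}$ is cycle-free; the final $Y$ is $Y(X)$ (this is defined whether or not $X\cup Y(X)$ is a spanning tree). Then for any two cycle-free sets $X_1\subseteq X_2\subseteq E^\ell$ we have $Y(X_1)\supseteq Y(X_2)$.
   Context: In the bilevel minimum spanning tree setting, $E^\ell$ are the edges controlled by the leader and $E^f$ those controlled by the follower, and the order $e_1,\dots,e_m$ is the follower's order of preference (nondecreasing in the follower's cost); the follower always builds his response with this same order, for every choice $X$ of the leader. -}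

module Defs where

open import Data.Nat using (ℕ; zero; suc; _<_)
open import Data.Fin using (Fin; fromℕ<)
open import Data.Fin.Subset using (Subset; _∈_; _∪_; ⁅_⁆; ⊥)
open import Data.Product using (_×_; _,_; Σ; ∃; ∃-syntax)
open import Data.Sum using (_⊎_; inj₁; inj₂)
open import Data.List using (List; []; _∷_)
open import Data.List.Relation.Unary.All using (All)
open import Data.List.Relation.Unary.Unique.Propositional using (Unique)
open import Relation.Nullary using (¬_)
open import Relation.Binary.PropositionalEquality using (_≡_)

-- A finite undirected multigraph G = (V, E) with V = Fin n and edge set
-- E = Eˡ ⊎ Eᶠ (disjoint union), Eˡ = Fin p (leader edges),
-- Eᶠ = Fin m (follower edges).  Every edge has two endpoints; walks may
-- traverse an edge in either direction (undirected); parallel edges are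
-- allowed since distinct edges may have the same endpoints.
-- The follower's fixed linear order e₁,…,e_m of Eᶠ is the order of Fin m.
record Graph (n p m : ℕ) : Set where
  field
    endsˡ : Fin p → Fin n × Fin n
    endsᶠ : Fin m → Fin n × Fin n

module _ {n p m : ℕ} (G : Graph n p m) where
  open Graph G

  Edge : Set
  Edge = Fin p ⊎ Fin m

  ends : Edge → Fin n × Fin n
  ends (inj₁ a) = endsˡ a
  ends (inj₂ b) = endsᶠ b

  data Step (e : Edge) (u v : Fin n) : Set where
    fwd : ends e ≡ (u , v) → Step e u v
    bwd : ends e ≡ (v , u) → Step e u v

  data Walk : Fin n → Fin n → List Edge → Set where
    [] : ∀ {u} → Walk u u []
    _∷_ : ∀ {u w v e es} → Step e u w → Walk w v es → Walk u v (e ∷ es)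

  _∈E[_,_] : Edge → Subset p → Subset m → Set
  inj₁ a ∈E[ X , Y ] = a ∈ X
  inj₂ b ∈E[ X , Y ] = b ∈ Y

  -- a cycle in the edge set X ∪ Y: a closed walk with at least one edge
  -- and no repeated edge, all of whose edges lie in X ∪ Y
  -- (loops give cycles of length 1, parallel edges cycles of length 2)
  Cycle : Subset p → Subset m → Set
  Cycle X Y = Σ Edge λ e → Σ (List Edge) λ es → Σ (Fin n) λ v →
    Walk v v (e ∷ es) × Unique (e ∷ es) × All (λ f → f ∈E[ X , Y ]) (e ∷ es)

  CycleFree : Subset p → Subset m → Set
  CycleFree X Y = ¬ Cycle X Y

  -- Greedy X i Y : after processing follower edges e₁,…,e_i (i.e. indices
  -- 0,…,i-1 of Fin m) starting from Y = ∅, the current set is Y.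
  data Greedy (X : Subset p) : ℕ → Subset m → Set where
    start : Greedy X 0 ⊥
    add   : ∀ {i Y} (i<m : i < m) → Greedy X i Y →
            CycleFree X (Y ∪ ⁅ fromℕ< i<m ⁆) →
            Greedy X (suc i) (Y ∪ ⁅ fromℕ< i<m ⁆)
    skip  : ∀ {i Y} (i<m : i < m) → Greedy X i Y →
            ¬ CycleFree X (Y ∪ ⁅ fromℕ< i<m ⁆) →
            Greedy X (suc i) Y

  Response : Subset p → Subset m → Set
  Response X Y = Greedy X m Y

-- Run both greedy procedures side by side under the invariant
-- "Y₂ ⊆ Y₁, and any two vertices joined in X₁ ∪ Y₁ are joined in X₂ ∪ Y₂"
-- (true at the start since X₁ ⊆ X₂).  Adding an edge to a cycle-free set
-- closes a cycle exactly when its ends are already joined.  Hence an edge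
-- rejected by run 1 has its ends joined in X₂ ∪ Y₂ as well and is rejected
-- by run 2, while an edge taken only by run 1 joins vertices that run 2
-- already joins.
module Submission where

open import Defs
open import Data.Empty using (⊥-elim)
open import Data.Fin using (Fin; fromℕ<; toℕ) renaming (_≟_ to _≟ᶠ_)
open import Data.Fin.Properties using (toℕ-fromℕ<)
open import Data.Fin.Subset using (Subset; _⊆_; _∈_; _∉_; _∪_; ⁅_⁆; ⊥)
open import Data.Fin.Subset.Properties
  using (∉⊥; x∈⁅x⁆; x∈⁅y⁆⇒x≡y; p⊆p∪q; ⊆-trans; x∈p∪q⁻; x∈p∪q⁺)
open import Data.List using (List; []; _∷_; _++_)
open import Data.List.Membership.Propositional using () renaming (_∈_ to _∈ₗ_; _∉_ to _∉ₗ_)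
open import Data.List.Membership.Propositional.Properties using (∈-∃++; ∈-insert)
open import Data.List.Relation.Unary.All using (All; []; _∷_)
import Data.List.Relation.Unary.All as All
open import Data.List.Relation.Unary.All.Properties using (¬Any⇒All¬; ++⁺; ++⁻ˡ; ++⁻ʳ)
open import Data.List.Relation.Unary.AllPairs using ([]; _∷_)
open import Data.List.Relation.Unary.Any using (here; there; any?)
open import Data.List.Relation.Unary.Unique.Propositional using (Unique)
open import Data.List.Relation.Unary.Unique.Propositional.Properties using (Unique[x∷xs]⇒x∉xs)
open import Data.Nat using (ℕ; _<_)
open import Data.Nat.Properties using (<-irrefl; m<n⇒m<1+n; n<1+n)
open import Data.Product using (_×_; _,_; proj₁; proj₂; ∃-syntax; ∃₂; uncurry)
open import Data.Sum using (_⊎_; inj₁; inj₂; [_,_])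
import Data.Sum as Sum
open import Data.Sum.Properties using (≡-dec)
open import Effect.Monad using (RawMonad)
open import Function using (id; _∘_)
open import Level using (0ℓ)
open import Relation.Binary.PropositionalEquality using (_≡_; _≢_; refl; sym; cong)
open import Relation.Nullary using (¬_; Dec; yes; no)
open import Relation.Nullary.Negation using (¬¬-Monad)

open RawMonad (¬¬-Monad {0ℓ})

∪-monoˡ-⊆ : ∀ {k} {p q : Subset k} (r : Subset k) → p ⊆ q → p ∪ r ⊆ q ∪ r
∪-monoˡ-⊆ {p = p} r p⊆q = x∈p∪q⁺ ∘ Sum.map₁ p⊆q ∘ x∈p∪q⁻ p r

x∈p∪⁅x⁆ : ∀ {k} {p : Subset k} x → x ∈ p ∪ ⁅ x ⁆
x∈p∪⁅x⁆ x = x∈p∪q⁺ (inj₂ (x∈⁅x⁆ x))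

module _ {n p m : ℕ} (G : Graph n p m) where

  private variable
    u v w : Fin n
    e g : Edge G
    es L₁ L₂ : List (Edge G)
    P Q : Edge G → Set
    i : ℕ
    f : Fin m
    X X′ X₁ X₂ : Subset p
    Y Y′ Y₁ Y₂ : Subset m

  _≟ₑ_ : (e g : Edge G) → Dec (e ≡ g)
  _≟ₑ_ = ≡-dec _≟ᶠ_ _≟ᶠ_

  Step-sym : Step G e u v → Step G e v u
  Step-sym (fwd eq) = bwd eq
  Step-sym (bwd eq) = fwd eq

  Step-ends : ∀ {x y} → Step G e u w → Step G e x y → (u ≡ x × w ≡ y) ⊎ (u ≡ y × w ≡ x)
  Step-ends (fwd refl) (fwd refl) = inj₁ (refl , refl)
  Step-ends (fwd refl) (bwd refl) = inj₂ (refl , refl)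
  Step-ends (bwd refl) (fwd refl) = inj₂ (refl , refl)
  Step-ends (bwd refl) (bwd refl) = inj₁ (refl , refl)

  Walk-++ : Walk G u v L₁ → Walk G v w L₂ → Walk G u w (L₁ ++ L₂)
  Walk-++ []      W′ = W′
  Walk-++ (s ∷ W) W′ = s ∷ Walk-++ W W′

  Walk-split : ∀ L₁ → Walk G u v (L₁ ++ g ∷ L₂) →
               ∃₂ λ x y → Walk G u x L₁ × Step G g x y × Walk G y v L₂
  Walk-split []       (s ∷ W) = _ , _ , [] , s , W
  Walk-split (_ ∷ L₁) (s ∷ W) =
    let x , y , W₁ , t , W₂ = Walk-split L₁ W in x , y , s ∷ W₁ , t , W₂

  Unique-++⁻ʳ : ∀ L₁ → Unique (L₁ ++ L₂) → Unique L₂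
  Unique-++⁻ʳ []       U       = U
  Unique-++⁻ʳ (_ ∷ L₁) (_ ∷ U) = Unique-++⁻ʳ L₁ U

  Unique-++-∉ˡ : ∀ L₁ → Unique (L₁ ++ g ∷ L₂) → g ∉ₗ L₁
  Unique-++-∉ˡ (_ ∷ L₁) (g≢ ∷ _) (here refl) = All.lookup g≢ (∈-insert L₁) refl
  Unique-++-∉ˡ (_ ∷ L₁) (_ ∷ U)  (there g∈)  = Unique-++-∉ˡ L₁ U g∈

  All-avoiding : (∀ {e} → Q e → g ≢ e → P e) → All Q es → g ∉ₗ es → All P es
  All-avoiding h A g∉ = All.zipWith (uncurry h) (A , ¬Any⇒All¬ _ g∉)

  Connected : (Edge G → Set) → Fin n → Fin n → Set
  Connected P u v = ∃[ es ] Walk G u v es × All P es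

  Connected-step : Step G e u v → P e → Connected P u v
  Connected-step s pe = _ , s ∷ [] , pe ∷ []

  Connected-trans : Connected P u v → Connected P v w → Connected P u w
  Connected-trans (_ , W , A) (_ , W′ , A′) = _ , Walk-++ W W′ , ++⁺ A A′

  Connected-sym : Connected P u v → Connected P v u
  Connected-sym (_ , []    , [])     = _ , [] , []
  Connected-sym (_ , s ∷ W , pe ∷ A) =
    Connected-trans (Connected-sym (_ , W , A)) (Connected-step (Step-sym s) pe)

  Connected-mono : (∀ {e} → P e → Q e) → Connected P u v → Connected Q u v
  Connected-mono h (_ , W , A) = _ , W , All.map h A

  EndsConnected : (Edge G → Set) → Edge G → Set
  EndsConnected P e = Connected P (proj₁ (ends G e)) (proj₂ (ends G e))

  EndsConnected-self : ∀ e → P e → EndsConnected P e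
  EndsConnected-self _ = Connected-step (fwd refl)

  EndsConnected⇒Connected : Step G e u v → EndsConnected P e → Connected P u v
  EndsConnected⇒Connected (fwd refl) c = c
  EndsConnected⇒Connected (bwd refl) c = Connected-sym c

  Connected⇒EndsConnected : Step G e u v → Connected P u v → EndsConnected P e
  Connected⇒EndsConnected (fwd refl) c = c
  Connected⇒EndsConnected (bwd refl) c = Connected-sym c

  ClosedTrail⇒EndsConnected : (∀ {e} → Q e → g ≢ e → P e) →
    Walk G v v es → Unique es → All Q es → g ∈ₗ es → EndsConnected P g
  ClosedTrail⇒EndsConnected h W U A g∈ with ∈-∃++ g∈
  ... | ys , _ , refl with Walk-split ys W
  ... | _ , _ , W₁ , t , W₂ =
    Connected⇒EndsConnected (Step-sym t) (Connected-trans
      (_ , W₂ , All-avoiding h (All.tail (++⁻ʳ ys A)) (Unique[x∷xs]⇒x∉xs (Unique-++⁻ʳ ys U)))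
      (_ , W₁ , All-avoiding h (++⁻ˡ ys A) (Unique-++-∉ˡ ys U)))

  Trail : (Edge G → Set) → Fin n → Fin n → Set
  Trail P u v = ∃[ es ] Walk G u v es × Unique es × All P es

  -- If e already occurs in the trail, cut the trail at that occurrence.
  Trail-cons : Step G e u w → P e → Trail P w v → Trail P u v
  Trail-cons {e = e} s pe (ts , W , U , A) with any? (e ≟ₑ_) ts
  ... | no e∉ = _ , s ∷ W , ¬Any⇒All¬ ts e∉ ∷ U , pe ∷ A
  ... | yes e∈ with ∈-∃++ e∈
  ... | ys , _ , refl with Walk-split ys W
  ... | _ , _ , _ , t , W₂ with Step-ends s t
  ... | inj₁ (refl , refl) = _ , s ∷ W₂ , Unique-++⁻ʳ ys U , ++⁻ʳ ys A
  ... | inj₂ (refl , refl) =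
    _ , W₂ , Unique-++⁻ʳ (e ∷ []) (Unique-++⁻ʳ ys U) , All.tail (++⁻ʳ ys A)

  Connected⇒Trail : Connected P u v → Trail P u v
  Connected⇒Trail (_ , []    , [])     = _ , [] , [] , []
  Connected⇒Trail (_ , s ∷ W , pe ∷ A) = Trail-cons s pe (Connected⇒Trail (_ , W , A))

  E[_,_] : Subset p → Subset m → Edge G → Set
  E[ X , Y ] e = _∈E[_,_] G e X Y

  E-mono : X ⊆ X′ → Y ⊆ Y′ → E[ X , Y ] e → E[ X′ , Y′ ] e
  E-mono {e = inj₁ _} X⊆X′ _ = X⊆X′
  E-mono {e = inj₂ _} _ Y⊆Y′ = Y⊆Y′

  E-∪⁅⁆⁻ : E[ X , Y ∪ ⁅ f ⁆ ] e → inj₂ f ≡ e ⊎ E[ X , Y ] e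
  E-∪⁅⁆⁻ {e = inj₁ _} e∈ = inj₂ e∈
  E-∪⁅⁆⁻ {Y = Y} {f} {inj₂ _} e∈ with x∈p∪q⁻ Y ⁅ f ⁆ e∈
  ... | inj₁ e∈Y  = inj₂ e∈Y
  ... | inj₂ e∈⁅f⁆ = inj₁ (cong inj₂ (sym (x∈⁅y⁆⇒x≡y f e∈⁅f⁆)))

  E-∪⁅⁆-≢ : E[ X , Y ∪ ⁅ f ⁆ ] e → inj₂ f ≢ e → E[ X , Y ] e
  E-∪⁅⁆-≢ e∈ f≢e = [ ⊥-elim ∘ f≢e , id ] (E-∪⁅⁆⁻ e∈)

  E-≢ : f ∉ Y → E[ X , Y ] e → inj₂ f ≢ e
  E-≢ f∉Y e∈ refl = f∉Y e∈

  Cycle-∪⁅⁆⁻ : Cycle G X (Y ∪ ⁅ f ⁆) → Cycle G X Y ⊎ EndsConnected E[ X , Y ] (inj₂ f)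
  Cycle-∪⁅⁆⁻ {f = f} (e , es , v , W , U , A) with any? (inj₂ f ≟ₑ_) (e ∷ es)
  ... | no f∉  = inj₁ (e , es , v , W , U , All-avoiding E-∪⁅⁆-≢ A f∉)
  ... | yes f∈ = inj₂ (ClosedTrail⇒EndsConnected E-∪⁅⁆-≢ W U A f∈)

  EndsConnected⇒Cycle-∪⁅⁆ : f ∉ Y → EndsConnected E[ X , Y ] (inj₂ f) → Cycle G X (Y ∪ ⁅ f ⁆)
  EndsConnected⇒Cycle-∪⁅⁆ {f = f} f∉Y c with Connected⇒Trail (Connected-sym c)
  ... | ts , W , U , A =
    inj₂ f , ts , _ , fwd refl ∷ W , All.map (E-≢ f∉Y) A ∷ U ,
    x∈p∪⁅x⁆ f ∷ All.map (E-mono id (p⊆p∪q ⁅ f ⁆)) A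

  Greedy-cycleFree : CycleFree G X ⊥ → Greedy G X i Y → CycleFree G X Y
  Greedy-cycleFree cf start        = cf
  Greedy-cycleFree cf (add _ _ cf′) = cf′
  Greedy-cycleFree cf (skip _ g _) = Greedy-cycleFree cf g

  Greedy-bound : ∀ {j} → Greedy G X i Y → j ∈ Y → toℕ j < i
  Greedy-bound start j∈ = ⊥-elim (∉⊥ j∈)
  Greedy-bound (add {Y = Y} i<m g _) j∈ with x∈p∪q⁻ Y ⁅ fromℕ< i<m ⁆ j∈
  ... | inj₁ j∈Y   = m<n⇒m<1+n (Greedy-bound g j∈Y)
  ... | inj₂ j∈⁅i⁆ rewrite x∈⁅y⁆⇒x≡y _ j∈⁅i⁆ | toℕ-fromℕ< i<m = n<1+n _
  Greedy-bound (skip _ g _) j∈ = m<n⇒m<1+n (Greedy-bound g j∈)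

  Greedy-fresh : Greedy G X i Y → (i<m : i < m) → fromℕ< i<m ∉ Y
  Greedy-fresh g i<m i∈Y = <-irrefl (toℕ-fromℕ< i<m) (Greedy-bound g i∈Y)

  ¬CycleFree-∪⁅⁆⇒EndsConnected : CycleFree G X Y → ¬ CycleFree G X (Y ∪ ⁅ f ⁆) →
    ¬ ¬ EndsConnected E[ X , Y ] (inj₂ f)
  ¬CycleFree-∪⁅⁆⇒EndsConnected cf ¬cf ¬c = ¬cf ([ cf , ¬c ] ∘ Cycle-∪⁅⁆⁻)

  -- Doubly negated: a rejected edge only tells us ¬ CycleFree, i.e. ¬ ¬ Cycle.
  Refines : (Edge G → Set) → (Edge G → Set) → Set
  Refines P Q = ∀ {u v} → Connected P u v → ¬ ¬ Connected Q u v

  Refines-edgewise : (∀ {e u v} → P e → Step G e u v → ¬ ¬ Connected Q u v) → Refines P Q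
  Refines-edgewise h (_ , []    , [])     = pure (_ , [] , [])
  Refines-edgewise h (_ , s ∷ W , pe ∷ A) = do
    c  ← h pe s
    c′ ← Refines-edgewise h (_ , W , A)
    pure (Connected-trans c c′)

  Refines-∪⁅⁆ : Refines E[ X , Y ] Q → ¬ ¬ EndsConnected Q (inj₂ f) →
    Refines E[ X , Y ∪ ⁅ f ⁆ ] Q
  Refines-∪⁅⁆ {X = X} {Y = Y} {Q = Q} {f = f} r c = Refines-edgewise edge
    where
    edge : ∀ {e u v} → E[ X , Y ∪ ⁅ f ⁆ ] e → Step G e u v → ¬ ¬ Connected Q u v
    edge e∈ s with E-∪⁅⁆⁻ {Y = Y} {f} e∈
    ... | inj₁ refl = EndsConnected⇒Connected s <$> c
    ... | inj₂ e∈′  = r (Connected-step s e∈′)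

  Greedy-antitone : CycleFree G X₁ ⊥ → CycleFree G X₂ ⊥ → X₁ ⊆ X₂ →
    Greedy G X₁ i Y₁ → Greedy G X₂ i Y₂ → Y₂ ⊆ Y₁ × Refines E[ X₁ , Y₁ ] E[ X₂ , Y₂ ]
  Greedy-antitone _ _ X₁⊆X₂ start start = id , pure ∘ Connected-mono (E-mono X₁⊆X₂ id)
  Greedy-antitone cf₁ cf₂ X₁⊆X₂ (add i<m g₁ _) (add _ g₂ _) =
    let Y₂⊆Y₁ , r = Greedy-antitone cf₁ cf₂ X₁⊆X₂ g₁ g₂
        f = fromℕ< i<m
    in ∪-monoˡ-⊆ ⁅ f ⁆ Y₂⊆Y₁
     , Refines-∪⁅⁆ {f = f} (λ c → Connected-mono (E-mono id (p⊆p∪q ⁅ f ⁆)) <$> r c)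
                   (pure (EndsConnected-self (inj₂ f) (x∈p∪⁅x⁆ f)))
  Greedy-antitone cf₁ cf₂ X₁⊆X₂ (add i<m g₁ _) (skip _ g₂ ¬cf₂) =
    let Y₂⊆Y₁ , r = Greedy-antitone cf₁ cf₂ X₁⊆X₂ g₁ g₂
    in ⊆-trans Y₂⊆Y₁ (p⊆p∪q ⁅ fromℕ< i<m ⁆)
     , Refines-∪⁅⁆ {f = fromℕ< i<m} r
         (¬CycleFree-∪⁅⁆⇒EndsConnected (Greedy-cycleFree cf₂ g₂) ¬cf₂)
  Greedy-antitone cf₁ cf₂ X₁⊆X₂ (skip i<m g₁ ¬cf₁) (add _ g₂ cf₂′) =
    let _ , r = Greedy-antitone cf₁ cf₂ X₁⊆X₂ g₁ g₂
    in ⊥-elim (¬CycleFree-∪⁅⁆⇒EndsConnected (Greedy-cycleFree cf₁ g₁) ¬cf₁ λ c →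
                 r c (cf₂′ ∘ EndsConnected⇒Cycle-∪⁅⁆ (Greedy-fresh g₂ i<m)))
  Greedy-antitone cf₁ cf₂ X₁⊆X₂ (skip _ g₁ _) (skip _ g₂ _) =
    Greedy-antitone cf₁ cf₂ X₁⊆X₂ g₁ g₂

lemma3 : ∀ {n p m} (G : Graph n p m) (X₁ X₂ : Subset p) →
    CycleFree G X₁ ⊥ → CycleFree G X₂ ⊥ → X₁ ⊆ X₂ →
    ∀ (Y₁ Y₂ : Subset m) → Response G X₁ Y₁ → Response G X₂ Y₂ →
    Y₂ ⊆ Y₁
lemma3 G _ _ cf₁ cf₂ X₁⊆X₂ _ _ r₁ r₂ = proj₁ (Greedy-antitone G cf₁ cf₂ X₁⊆X₂ r₁ r₂)
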